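{- Let $H=(V,E)$ be a hypergraph, $\kappa\in\mathbb{R}$, and let $V_1,\dots,V_k$ be a partition of $V$ into sets each inducing a connected sub-hypergraph of strength greater than $\kappa$ in $H$. Then the hyperedges of $H$ of strength at most $\kappa$ (in $H$) are exactly those hyperedges $e$ whose contracted image $e/(V_1,\dots,V_k)$ is a hyperedge of strength at most $\kappa$ in $H/(V_1,\dots,V_k)$.
   Context: A hypergraph $H=(V,E)$ has a finite vertex set $V$ and a (multi)set $E$ of hyperedges, each a subset of $V$ with at least two vertices. For a partition of the vertex set into nonempty parts $W_1,\dots,W_t$, $E[W_1,\dots,W_t]$ is the set of hyperedges not contained in any single part. $\Phi(H)=\min_{2\le t\le |V|}\min_{W_1\cup\dots\cup W_t=V}|E[W_1,\dots,W_t]|/(t-1)$ over partitions into $t$ nonempty parts. For $S\subseteq V$, $H[S]$ is the sub-hypergraph on $S$ of hyperedges contained in $S$; $S$ induces a connected sub-hypergraph if it cannot be split into two nonempty parts with no hyperedge of $H[S]$ meeting both. Strength is defined recursively: choose a partition attaining $\Phi$; each crossing hyperedge gets strength equal to $\Phi$; every other hyperedge lies in some part and gets its strength recursively computed inside the induced sub-hypergraph on that part. The strength of a vertex set $S$ in $H$ is the minimum strength (in $H$) of hyperedges contained in $S$ ($+\infty$ if none). The contracted hypergraph $H/(V_1,\dots,V_k)$ has one super-vertex per $V_i$; each hyperedge $e$ of $H$ maps to $e/(V_1,\dots,V_k)=\{i: e\cap V_i\neq\emptyset\}$ (as a multiset of hyperedges); images consisting of a single super-vertex (self-loops) are discarded,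 so only hyperedges not contained in a single $V_i$ have images in $H/(V_1,\dots,V_k)$.
   Formalization: The threshold κ ranges over the rationals rather than over ℝ. -}

module Defs where

open import Data.Nat using (ℕ; suc; _≤_; _+_)
open import Data.Integer using (+_)
open import Data.Rational using (ℚ; _/_)
open import Data.Fin using (Fin; _≟_)
open import Data.Fin.Properties using (any?)
open import Data.Fin.Subset using (Subset; _∈_; _⊆_; _∩_; _─_; Nonempty; ⊤)
open import Data.Fin.Subset.Properties using (_∈?_; _⊆?_)
open import Data.Vec using (tabulate)
open import Data.List using (List; length; filter)
import Data.Rational
import Data.Fin.Properties
import Relation.Nullary
import Relation.Nullary.Decidable
open import Data.List.Membership.Propositional using () renaming (_∈_ to _∈ₗ_)
open import Data.List.Relation.Unary.Any using ()
open import Data.Product using (∃; _×_; _,_)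
open import Relation.Nullary using (¬_; ¬?; does)
open import Relation.Nullary.Decidable using (_×-dec_)
open import Relation.Binary.PropositionalEquality using (_≡_)

-- A (multi)family of hyperedges on the vertex set Fin n:
-- an index type I, a list `es` of the hyperedge indices (each index listed
-- once), and the vertex set `E e` of each hyperedge.  Multi-edges are
-- distinct indices with the same vertex set.

module Hyp {n : ℕ} {I : Set} (es : List I) (E : I → Subset n) where

  -- Partition of a vertex set U ⊆ V into t = 2 + k parts, given by a
  -- labelling f : Fin n → Fin (2 + k) (only the values on U matter);
  -- every part must be nonempty.
  NonemptyParts : ∀ {k} → Subset n → (Fin n → Fin (2 + k)) → Set
  NonemptyParts U f = ∀ i → ∃ λ v → v ∈ U × f v ≡ i

  part : ∀ {t} → Subset n → (Fin n → Fin t) → Fin t → Subset n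
  part U f i = tabulate (λ v → does (v ∈? U ×-dec f v ≟ i))

  SinglePart : ∀ {t} → (Fin n → Fin t) → I → Set
  SinglePart f e = ∃ λ i → ∀ v → v ∈ E e → f v ≡ i

  singlePart? : ∀ {t} (f : Fin n → Fin t) (e : I) → Relation.Nullary.Dec (SinglePart f e)
  singlePart? f e = any? (λ i → Data.Fin.Properties.all? (λ v → Relation.Nullary.Decidable._→-dec_ (v ∈? E e) (f v ≟ i)))

  crossCount : ∀ {t} → Subset n → (Fin n → Fin t) → ℕ
  crossCount U f = length (filter (λ e → (E e ⊆? U) ×-dec ¬? (singlePart? f e)) es)

  -- |E[W_1,…,W_t]| / (t - 1)  with t = 2 + k
  ratio : ∀ {k} → Subset n → (Fin n → Fin (2 + k)) → ℚ
  ratio {k} U f = (+ crossCount U f) / suc k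

  Attains : ∀ {k} → Subset n → (Fin n → Fin (2 + k)) → Set
  Attains U f = ∀ k' (g : Fin n → Fin (2 + k')) → NonemptyParts U g →
                Data.Rational._≤_ (ratio U f) (ratio U g)

  -- StrengthOn U s : s assigns to every hyperedge of H[U] its strength
  -- in H[U], following the recursive definition: choose a partition
  -- attaining Φ(H[U]); crossing hyperedges get Φ(H[U]); the others get
  -- their strength recursively inside the part containing them.
  data StrengthOn (s : I → ℚ) : Subset n → Set where
    leaf : ∀ {U} → (∀ e → e ∈ₗ es → ¬ (E e ⊆ U)) → StrengthOn s U
    node : ∀ {U} (k : ℕ) (f : Fin n → Fin (2 + k)) →
           NonemptyParts U f →
           Attains U f →
           (∀ e → e ∈ₗ es → E e ⊆ U → ¬ SinglePart f e → s e ≡ ratio U f) →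
           (∀ i → StrengthOn s (part U f i)) →
           StrengthOn s U

  IsStrength : (I → ℚ) → Set
  IsStrength s = StrengthOn s ⊤

  Connected : Subset n → Set
  Connected S = ¬ (∃ λ (A : Subset n) → A ⊆ S × Nonempty A × Nonempty (S ─ A) ×
                   (∀ e → e ∈ₗ es → E e ⊆ S →
                      ¬ (Nonempty (A ∩ E e) × Nonempty ((S ─ A) ∩ E e))))

-- Partition V_1,…,V_k of Fin n given by a labelling p : Fin n → Fin k.

block : ∀ {n k} → (Fin n → Fin k) → Fin k → Subset n
block p i = tabulate (λ v → does (p v ≟ i))

InBlock : ∀ {n k m} → (Fin n → Fin k) → (Fin m → Subset n) → Fin m → Set
InBlock p E e = ∃ λ i → E e ⊆ block p i

inBlock? : ∀ {n k m} (p : Fin n → Fin k) (E : Fin m → Subset n) (e : Fin m) →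
           Relation.Nullary.Dec (InBlock p E e)
inBlock? p E e = any? (λ i → E e ⊆? block p i)

contractEdge : ∀ {n k m} → (Fin n → Fin k) → (Fin m → Subset n) → Fin m → Subset k
contractEdge p E e = tabulate (λ i → does (any? (λ v → v ∈? E e ×-dec p v ≟ i)))

-- hyperedges of H/(V_1,…,V_k): images of the hyperedges not contained in a
-- single V_i (self-loops discarded), indexed by the original hyperedge.
contractEdges : ∀ {n k m} → (Fin n → Fin k) → (Fin m → Subset n) → List (Fin m)
contractEdges p E = filter (λ e → ¬? (inBlock? p E e)) (Data.List.allFin _)

{-# OPTIONS --safe #-}

-- Write Φ(X) for Φ(H[X]). The strength of a hyperedge e is the largest Φ(X) over the vertex sets X ⊇ e:
-- the recursion defining it ends at a part X ⊇ e with Φ(X) = s e, and an optimal partition of W can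
-- neither be beaten on a subset meeting several of its parts (merge those parts) nor inside one of its
-- parts (refine that part). Hence s e > κ iff E e lies in a set X with Φ(X) > κ. Two such sets sharing a
-- vertex have a union with Φ > κ (a mediant inequality), so every block V_i, being connected with all
-- its hyperedges of strength > κ, lies in such a set. A set of H/(V_1,…,V_k) with Φ > κ pulls back to a
-- union of blocks that beats κ on all partitions not cutting a block; gluing on the sets around the
-- blocks makes it beat κ on all partitions. Conversely, a set with Φ > κ in H can be enlarged block by
-- block until it is a union of blocks, and then its image in H/(V_1,…,V_k) has Φ > κ.

module Submission where

open import Defs
open import Data.Nat as ℕ using (ℕ; zero; suc; _+_; _*_; _∸_; _≤_; z≤n; s≤s)
import Data.Nat.Properties as ℕ
open import Data.Integer as ℤ using (+_; +≤+)
import Data.Integer.Properties as ℤ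
open import Data.Rational as ℚ using (ℚ; _/_; ↥_; ↧_; _<_) renaming (_≤_ to _≤ℚ_)
import Data.Rational.Properties as ℚ
open import Data.Rational.Unnormalised using (mkℚᵘ; *≤*; *<*)
open import Data.Rational.Unnormalised.Properties using (≤-respˡ-≃; ≤-respʳ-≃; <-respʳ-≃; ≃-sym)
open import Data.Fin using (Fin; zero; suc; _≟_; _↑ˡ_; _↑ʳ_)
open import Data.Fin.Properties using (any?)
open import Data.Fin.Subset using (Subset; _∈_; _∉_; _⊆_; _⊂_; _⊃_; _∪_; _∩_; _─_; ⁅_⁆; Nonempty; inside; outside; ∣_∣)
open import Data.Fin.Subset.Properties
  using (_∈?_; _⊆?_; nonempty?; ∈⊤; x∈⁅x⁆; x∈⁅y⁆⇒x≡y; x∈p∪q⁻; p⊆p∪q; q⊆p∪q; x∈p∩q⁻; x∈p∧x∉q⇒x∈p─q)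
open import Data.Fin.Subset.Induction using (⊃-wellFounded)
import Data.Vec as Vec
open import Data.Vec using (_∷_; here; there)
open import Data.Vec.Properties using (lookup∘tabulate; lookup⇒[]=; []=⇒lookup)
open import Data.List using (List; []; _∷_; length; filter; allFin; lookup; tabulate)
open import Data.List.Properties using (length-tabulate; filter-≐; filter-some; filter-none)
open import Data.List.Membership.Propositional using (lose) renaming (_∈_ to _∈ₗ_)
open import Data.List.Membership.Propositional.Properties using (∈-filter⁺; ∈-filter⁻; ∈-allFin; ∈-lookup)
open import Data.List.Membership.Setoid.Properties using (index-injective; unique⇒irrelevant)
import Data.List.Membership.DecPropositional as DecMembership
open import Data.List.Relation.Binary.Sublist.Propositional using (⊆-refl)
open import Data.List.Relation.Binary.Sublist.Propositional.Properties using (filter⁺; length-mono-≤)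
open import Data.List.Relation.Unary.Any using (index; here; there)
import Data.List.Relation.Unary.All as All
open import Data.List.Relation.Unary.AllPairs using ([]; _∷_)
open import Data.List.Relation.Unary.Unique.Propositional using (Unique)
import Data.List.Relation.Unary.Unique.Propositional.Properties as Unique
open import Data.Product using (∃; Σ; _×_; _,_; proj₁; proj₂)
open import Data.Sum using (_⊎_; inj₁; inj₂; [_,_])
open import Data.Empty using (⊥; ⊥-elim)
open import Function using (_∘_; id)
open import Function.Bundles using (_⇔_; mk⇔; module Equivalence)
open import Axiom.UniquenessOfIdentityProofs using (module Decidable⇒UIP)
open import Induction.WellFounded using (Acc; acc)
open import Relation.Nullary using (¬_; Dec; yes; no; does; ¬?; contradiction)
open import Relation.Nullary.Decidable using (_×-dec_; dec-true; decidable-stable)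
open import Relation.Unary as U using (Decidable; _≐_)
open import Relation.Unary.Properties using (∁?; _∩?_)
open import Relation.Binary.PropositionalEquality
  using (_≡_; _≢_; refl; sym; trans; cong; cong₂; subst; subst₂; setoid; module ≡-Reasoning)

count : ∀ {A : Set} {P : A → Set} → Decidable P → List A → ℕ
count P? xs = length (filter P? xs)

module _ {A : Set} where

  private variable P Q R : A → Set

  count-≐ : (P? : Decidable P) (Q? : Decidable Q) → P ≐ Q → ∀ xs → count P? xs ≡ count Q? xs
  count-≐ P? Q? P≐Q xs = cong length (filter-≐ P? Q? P≐Q xs)

  count-mono : (P? : Decidable P) (Q? : Decidable Q) → P U.⊆ Q → ∀ xs → count P? xs ≤ count Q? xs
  count-mono P? Q? P⊆Q xs = length-mono-≤ (filter⁺ P? Q? (λ { refl → P⊆Q }) (⊆-refl {x = xs}))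

  count-mono-< : (P? : Decidable P) (Q? : Decidable Q) → P U.⊆ Q →
                 ∀ {x xs} → x ∈ₗ xs → Q x → ¬ P x → count P? xs ℕ.< count Q? xs
  count-mono-< P? Q? P⊆Q {xs = y ∷ ys} (here refl) Qx ¬Px with P? y | Q? y
  ... | yes Py | _     = contradiction Py ¬Px
  ... | no _   | no ¬Qy = contradiction Qx ¬Qy
  ... | no _   | yes _ = s≤s (count-mono P? Q? P⊆Q ys)
  count-mono-< P? Q? P⊆Q {xs = y ∷ ys} (there x∈ys) Qx ¬Px with P? y | Q? y
  ... | yes Py | no ¬Qy = contradiction (P⊆Q Py) ¬Qy
  ... | yes _  | yes _ = s≤s (count-mono-< P? Q? P⊆Q x∈ys Qx ¬Px)
  ... | no _   | yes _ = ℕ.m≤n⇒m≤1+n (count-mono-< P? Q? P⊆Q x∈ys Qx ¬Px)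
  ... | no _   | no _  = count-mono-< P? Q? P⊆Q x∈ys Qx ¬Px

  count-filter : (P? : Decidable P) (Q? : Decidable Q) → ∀ xs → count Q? (filter P? xs) ≡ count (P? ∩? Q?) xs
  count-filter P? Q? [] = refl
  count-filter P? Q? (x ∷ xs) with P? x
  ... | no _ = count-filter P? Q? xs
  ... | yes _ with Q? x
  ...   | yes _ = cong suc (count-filter P? Q? xs)
  ...   | no _ = count-filter P? Q? xs

  length≡count+count∁ : (P? : Decidable P) → ∀ xs → length xs ≡ count P? xs + count (∁? P?) xs
  length≡count+count∁ P? [] = refl
  length≡count+count∁ P? (x ∷ xs) with P? x
  ... | yes _ = cong suc (length≡count+count∁ P? xs)
  ... | no _ = trans (cong suc (length≡count+count∁ P? xs)) (sym (ℕ.+-suc _ _))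

  count-split : (P? : Decidable P) (Q? : Decidable Q) → ∀ xs →
                count P? xs ≡ count (P? ∩? Q?) xs + count (P? ∩? ∁? Q?) xs
  count-split P? Q? xs = begin
    length (filter P? xs)                                     ≡⟨ length≡count+count∁ Q? (filter P? xs) ⟩
    count Q? (filter P? xs) + count (∁? Q?) (filter P? xs)    ≡⟨ cong₂ _+_ (count-filter P? Q? xs) (count-filter P? (∁? Q?) xs) ⟩
    count (P? ∩? Q?) xs + count (P? ∩? ∁? Q?) xs              ∎
    where open ≡-Reasoning

  count-disjoint : (P? : Decidable P) (Q? : Decidable Q) (R? : Decidable R) →
                   P U.⊆ R → Q U.⊆ R → P U.⊆ U.∁ Q → ∀ xs → count P? xs + count Q? xs ≤ count R? xs
  count-disjoint P? Q? R? P⊆R Q⊆R P⊆∁Q xs = begin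
    count P? xs + count Q? xs                     ≤⟨ ℕ.+-mono-≤ (count-mono P? (R? ∩? ∁? Q?) (λ Px → P⊆R Px , P⊆∁Q Px) xs)
                                                                  (count-mono Q? (R? ∩? Q?) (λ Qx → Q⊆R Qx , Qx) xs) ⟩
    count (R? ∩? ∁? Q?) xs + count (R? ∩? Q?) xs  ≡⟨ ℕ.+-comm (count (R? ∩? ∁? Q?) xs) _ ⟩
    count (R? ∩? Q?) xs + count (R? ∩? ∁? Q?) xs  ≡⟨ count-split R? Q? xs ⟨
    count R? xs                                   ∎
    where open ℕ.≤-Reasoning

  count-cover : ∀ {P Q R : A → Set} (P? : Decidable P) (Q? : Decidable Q) (R? : Decidable R) →
                P U.⊆ Q U.∪ R → ∀ xs → count P? xs ≤ count Q? xs + count R? xs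
  count-cover {P} {Q} {R} P? Q? R? P⊆Q∪R xs = begin
    count P? xs                                   ≡⟨ count-split P? Q? xs ⟩
    count (P? ∩? Q?) xs + count (P? ∩? ∁? Q?) xs  ≤⟨ ℕ.+-mono-≤ (count-mono (P? ∩? Q?) Q? proj₂ xs)
                                                                  (count-mono (P? ∩? ∁? Q?) R? outside-Q xs) ⟩
    count Q? xs + count R? xs                     ∎
    where
    open ℕ.≤-Reasoning
    outside-Q : P U.∩ U.∁ Q U.⊆ R
    outside-Q (Px , ¬Qx) = [ (λ Qx → contradiction Qx ¬Qx) , id ] (P⊆Q∪R Px)

  count>0⇒∃ : (P? : Decidable P) → ∀ xs → 0 ℕ.< count P? xs → ∃ P
  count>0⇒∃ P? (x ∷ xs) pos with P? x
  ... | yes Px = x , Px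
  ... | no _ = count>0⇒∃ P? xs pos

  count-≥2 : (P? : Decidable P) → ∀ {x y xs} → x ∈ₗ xs → y ∈ₗ xs → x ≢ y → P x → P y → 2 ≤ count P? xs
  count-≥2 P? (here refl) (here refl) x≢y _ _ = contradiction refl x≢y
  count-≥2 P? {xs = z ∷ _} (here refl) (there y∈xs) _ Px Py with P? z
  ... | yes _ = s≤s (filter-some P? (lose y∈xs Py))
  ... | no ¬Px = contradiction Px ¬Px
  count-≥2 P? {xs = z ∷ _} (there x∈xs) (here refl) _ Px Py with P? z
  ... | yes _ = s≤s (filter-some P? (lose x∈xs Px))
  ... | no ¬Py = contradiction Py ¬Py
  count-≥2 P? {xs = z ∷ _} (there x∈xs) (there y∈xs) x≢y Px Py with P? z
  ... | yes _ = ℕ.m≤n⇒m≤1+n (count-≥2 P? x∈xs y∈xs x≢y Px Py)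
  ... | no _ = count-≥2 P? x∈xs y∈xs x≢y Px Py

  count-≤1 : (P? : Decidable P) → (∀ {x y} → P x → P y → x ≡ y) → ∀ {xs} → Unique xs → count P? xs ≤ 1
  count-≤1 P? P-unique [] = z≤n
  count-≤1 P? P-unique {x ∷ xs} (x∉xs ∷ xs!) with P? x
  ... | no _ = count-≤1 P? P-unique xs!
  ... | yes Px = s≤s (ℕ.≤-reflexive (cong length (filter-none P? (All.map (λ x≢y Py → x≢y (P-unique Px Py)) x∉xs))))

  count-tabulate-mono : ∀ {n} {B : Set} {Q : B → Set} (P? : Decidable P) (Q? : Decidable Q) (φ : Fin n → A) (ψ : Fin n → B) →
                        (∀ i → P (φ i) → Q (ψ i)) → count P? (tabulate φ) ≤ count Q? (tabulate ψ)
  count-tabulate-mono {n = zero} P? Q? φ ψ PφQψ = z≤n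
  count-tabulate-mono {n = suc n} P? Q? φ ψ PφQψ with P? (φ zero) | Q? (ψ zero)
    | count-tabulate-mono P? Q? (φ ∘ suc) (ψ ∘ suc) (PφQψ ∘ suc)
  ... | yes Pφ | no ¬Qψ | _ = contradiction (PφQψ zero Pφ) ¬Qψ
  ... | yes _ | yes _ | ih = s≤s ih
  ... | no _ | yes _ | ih = ℕ.m≤n⇒m≤1+n ih
  ... | no _ | no _ | ih = ih

  count-tabulate-+ : (P? : Decidable P) → ∀ a {b} (f : Fin (a + b) → A) →
                     count P? (tabulate f) ≡ count P? (tabulate (f ∘ (_↑ˡ b))) + count P? (tabulate (f ∘ (a ↑ʳ_)))
  count-tabulate-+ P? zero f = refl
  count-tabulate-+ P? (suc a) f with P? (f zero)
  ... | yes _ = cong suc (count-tabulate-+ P? a (f ∘ suc))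
  ... | no _ = count-tabulate-+ P? a (f ∘ suc)

count+count∁-allFin : ∀ {t} {P : Fin t → Set} (P? : Decidable P) → count P? (allFin t) + count (∁? P?) (allFin t) ≡ t
count+count∁-allFin {t} P? = trans (sym (length≡count+count∁ P? (allFin t))) (length-tabulate id)

count-≢ : ∀ {t} (j : Fin (suc t)) → t ≤ count (∁? (_≟ j)) (allFin (suc t))
count-≢ {t} j = ℕ.≤-pred (begin
  suc t                                                 ≡⟨ count+count∁-allFin (_≟ j) ⟨
  count (_≟ j) (allFin _) + count (∁? (_≟ j)) (allFin _)  ≤⟨ ℕ.+-monoˡ-≤ _ (count-≤1 (_≟ j) j-unique (Unique.allFin⁺ _)) ⟩
  suc (count (∁? (_≟ j)) (allFin _))                    ∎)
  where
  open ℕ.≤-Reasoning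
  j-unique : ∀ {i i′} → i ≡ j → i′ ≡ j → i ≡ i′
  j-unique i≡j i′≡j = trans i≡j (sym i′≡j)

select : ∀ {n} {P : Fin n → Set} → Decidable P → Subset n
select P? = Vec.tabulate (does ∘ P?)

module _ {n : ℕ} {P : Fin n → Set} (P? : Decidable P) {v : Fin n} where

  ∈-select⁺ : P v → v ∈ select P?
  ∈-select⁺ Pv = lookup⇒[]= v (select P?) (trans (lookup∘tabulate _ v) (dec-true (P? v) Pv))

  ∈-select⁻ : v ∈ select P? → P v
  ∈-select⁻ v∈ with P? v | trans (sym (lookup∘tabulate (does ∘ P?) v)) ([]=⇒lookup v∈)
  ... | yes Pv | _ = Pv

x∈p─q⇒x∉q : ∀ {n} {p q : Subset n} {x} → x ∈ p ─ q → x ∉ q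
x∈p─q⇒x∉q {p = _ ∷ p} {inside ∷ q} (there x∈) (there x∈q) = x∈p─q⇒x∉q x∈ x∈q
x∈p─q⇒x∉q {p = _ ∷ p} {outside ∷ q} (there x∈) (there x∈q) = x∈p─q⇒x∉q x∈ x∈q

⊈⇒∃∉ : ∀ {n} {p q : Subset n} → ¬ (p ⊆ q) → ∃ λ x → x ∈ p × x ∉ q
⊈⇒∃∉ {p = p} {q} p⊈q with any? (λ x → (x ∈? p) ×-dec ¬? (x ∈? q))
... | yes witness = witness
... | no none = contradiction (λ {x} x∈p → decidable-stable (x ∈? q) (λ x∉q → none (x , x∈p , x∉q))) p⊈q

grow : ∀ {n} (P Done : Subset n → Set) → Decidable Done →
       (∀ {X} → P X → ¬ Done X → ∃ λ Y → X ⊂ Y × P Y) → ∀ {X} → P X → ∃ λ Y → P Y × Done Y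
grow P Done done? step {X} = go (⊃-wellFounded X)
  where
  go : ∀ {X} → Acc _⊃_ X → P X → ∃ λ Y → P Y × Done Y
  go {X} (acc larger) PX with done? X
  ... | yes doneX = X , PX , doneX
  ... | no ¬doneX with step PX ¬doneX
  ...   | Y , X⊂Y , PY = go (larger X⊂Y) PY

-- Kept opaque: unfolding the normalising division makes unification and type checking blow up.
opaque
  frac : ℕ → ℕ → ℚ
  frac c d = + c / suc d

private
  +*+ : ∀ m n → + m ℤ.* + n ≡ + (m * n)
  +*+ m n = sym (ℤ.pos-* m n)

opaque
  unfolding frac

  frac-≤ : ∀ {a b c d} → a * suc d ≤ c * suc b → frac a b ≤ℚ frac c d
  frac-≤ {a} {b} {c} {d} ad≤cb = ℚ.toℚᵘ-cancel-≤
    (≤-respʳ-≃ (≃-sym (ℚ.toℚᵘ-fromℚᵘ (mkℚᵘ (+ c) d)))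
    (≤-respˡ-≃ (≃-sym (ℚ.toℚᵘ-fromℚᵘ (mkℚᵘ (+ a) b)))
      (*≤* (subst₂ ℤ._≤_ (sym (+*+ a (suc d))) (sym (+*+ c (suc b))) (+≤+ ad≤cb)))))

  frac-≤⁻ : ∀ {a b c d} → frac a b ≤ℚ frac c d → a * suc d ≤ c * suc b
  frac-≤⁻ {a} {b} {c} {d} ab≤cd with ≤-respʳ-≃ (ℚ.toℚᵘ-fromℚᵘ (mkℚᵘ (+ c) d))
    (≤-respˡ-≃ (ℚ.toℚᵘ-fromℚᵘ (mkℚᵘ (+ a) b)) (ℚ.toℚᵘ-mono-≤ ab≤cd))
  ... | *≤* ad≤cb = ℤ.drop‿+≤+ (subst₂ ℤ._≤_ (+*+ a (suc d)) (+*+ c (suc b)) ad≤cb)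

  <frac⇔ : ∀ {κ a b} → κ < frac a b ⇔ ↥ κ ℤ.* + suc b ℤ.< + a ℤ.* ↧ κ
  <frac⇔ {κ@record{}} {a} {b} = mk⇔ to from
    where
    to : κ < frac a b → ↥ κ ℤ.* + suc b ℤ.< + a ℤ.* ↧ κ
    to κ<ab with <-respʳ-≃ (ℚ.toℚᵘ-fromℚᵘ (mkℚᵘ (+ a) b)) (ℚ.toℚᵘ-mono-< κ<ab)
    ... | *<* lt = lt
    from : ↥ κ ℤ.* + suc b ℤ.< + a ℤ.* ↧ κ → κ < frac a b
    from lt = ℚ.toℚᵘ-cancel-< (<-respʳ-≃ (≃-sym (ℚ.toℚᵘ-fromℚᵘ (mkℚᵘ (+ a) b))) (*<* lt))

frac-mono : ∀ {a b c d} → a ≤ c → d ≤ b → frac a b ≤ℚ frac c d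
frac-mono a≤c d≤b = frac-≤ (ℕ.*-mono-≤ a≤c (s≤s d≤b))

<-mediant : ∀ {κ a b c d} → κ < frac a b → κ < frac c d → κ < frac (a + c) (suc (b + d))
<-mediant {κ} {a} {b} {c} {d} κ<ab κ<cd = Equivalence.from <frac⇔ (begin-strict
  ↥ κ ℤ.* + suc (suc (b + d))           ≡⟨ cong (λ m → ↥ κ ℤ.* + suc m) (ℕ.+-suc b d) ⟨
  ↥ κ ℤ.* (+ suc b ℤ.+ + suc d)         ≡⟨ ℤ.*-distribˡ-+ (↥ κ) (+ suc b) (+ suc d) ⟩
  ↥ κ ℤ.* + suc b ℤ.+ ↥ κ ℤ.* + suc d   <⟨ ℤ.+-mono-< (Equivalence.to <frac⇔ κ<ab) (Equivalence.to <frac⇔ κ<cd) ⟩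
  + a ℤ.* ↧ κ ℤ.+ + c ℤ.* ↧ κ           ≡⟨ ℤ.*-distribʳ-+ (↧ κ) (+ a) (+ c) ⟨
  + (a + c) ℤ.* ↧ κ                     ∎)
  where open ℤ.≤-Reasoning

-- Used with c, C the crossings of U and of W under an optimal f with 2 + k parts, c′ and p the crossings
-- and parts of W after merging the r parts that meet U.
coarsening-bound : ∀ {c c′ C k} p r → c + c′ ≤ C → (2 ≤ p → C * suc (p ∸ 2) ≤ c′ * suc k) →
                   3 + k ≤ r + p → 2 ≤ r → c * suc k ≤ C * suc (r ∸ 2)
coarsening-bound {c} {c′} {C} {k} p (suc (suc r)) c+c′≤C optimal parts _ =
  ℕ.+-cancelʳ-≤ (C * (p ∸ 1)) (c * suc k) (C * suc r) (begin
    c * suc k + C * (p ∸ 1)   ≤⟨ ℕ.+-monoʳ-≤ (c * suc k) (optimal′ p optimal) ⟩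
    c * suc k + c′ * suc k    ≡⟨ ℕ.*-distribʳ-+ (suc k) c c′ ⟨
    (c + c′) * suc k          ≤⟨ ℕ.*-monoˡ-≤ (suc k) c+c′≤C ⟩
    C * suc k                 ≤⟨ ℕ.*-monoʳ-≤ C (parts′ p parts) ⟩
    C * ((p ∸ 1) + suc r)     ≡⟨ ℕ.*-distribˡ-+ C (p ∸ 1) (suc r) ⟩
    C * (p ∸ 1) + C * suc r   ≡⟨ ℕ.+-comm (C * (p ∸ 1)) (C * suc r) ⟩
    C * suc r + C * (p ∸ 1)   ∎)
  where
  open ℕ.≤-Reasoning
  optimal′ : ∀ p → (2 ≤ p → C * suc (p ∸ 2) ≤ c′ * suc k) → C * (p ∸ 1) ≤ c′ * suc k
  optimal′ zero _ rewrite ℕ.*-zeroʳ C = z≤n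
  optimal′ (suc zero) _ rewrite ℕ.*-zeroʳ C = z≤n
  optimal′ (suc (suc p)) optimal = optimal (s≤s (s≤s z≤n))
  parts′ : ∀ p → 3 + k ≤ suc (suc r) + p → suc k ≤ (p ∸ 1) + suc r
  parts′ zero parts rewrite ℕ.+-identityʳ r = ℕ.m≤n⇒m≤1+n (ℕ.≤-pred (ℕ.≤-pred parts))
  parts′ (suc p) parts rewrite ℕ.+-suc r p | ℕ.+-comm p (suc r) = ℕ.≤-pred (ℕ.≤-pred parts)
coarsening-bound p (suc zero) _ _ _ (s≤s ())

-- Used with C the crossings of W under an optimal f with 2 + k parts, c and r the crossings and parts of a
-- partition of one part of f, and C′, p those of W after refining f by it.
refinement-bound : ∀ {C C′ c k} p r → C * suc (p ∸ 2) ≤ C′ * suc k → C′ ≤ C + c →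
                   r + suc k ≤ p → 2 ≤ r → C * suc (r ∸ 2) ≤ c * suc k
refinement-bound {C} {C′} {c} {k} (suc (suc p)) (suc (suc r)) optimal C′≤C+c parts _ =
  ℕ.+-cancelʳ-≤ (C * suc k) (C * suc r) (c * suc k) (begin
    C * suc r + C * suc k   ≡⟨ ℕ.*-distribˡ-+ C (suc r) (suc k) ⟨
    C * (suc r + suc k)     ≤⟨ ℕ.*-monoʳ-≤ C (ℕ.≤-pred parts) ⟩
    C * suc p               ≤⟨ optimal ⟩
    C′ * suc k              ≤⟨ ℕ.*-monoˡ-≤ (suc k) C′≤C+c ⟩
    (C + c) * suc k         ≡⟨ ℕ.*-distribʳ-+ (suc k) C c ⟩
    C * suc k + c * suc k   ≡⟨ ℕ.+-comm (C * suc k) (c * suc k) ⟩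
    c * suc k + C * suc k   ∎)
  where open ℕ.≤-Reasoning
refinement-bound (suc zero) (suc (suc r)) _ _ (s≤s ()) _
refinement-bound zero (suc (suc r)) _ _ () _
refinement-bound p (suc zero) _ _ _ (s≤s ())

<⇒≱ : ∀ {x y : ℚ} → x < y → ¬ y ≤ℚ x
<⇒≱ x<y y≤x = ℚ.<-irrefl refl (ℚ.<-≤-trans x<y y≤x)

private
  <-frac-from : ∀ {κ x a c} p → κ < frac x a → x ≤ c → p ≤ 2 + a → κ < frac c (p ∸ 2)
  <-frac-from p κ<xa x≤c p≤2+a = ℚ.<-≤-trans κ<xa (frac-mono x≤c (ℕ.∸-monoˡ-≤ 2 p≤2+a))

  2≤2+ : ∀ {a} → 2 ≤ 2 + a
  2≤2+ = s≤s (s≤s z≤n)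

  too-few-parts : ∀ {p} → 2 ≤ p → suc p ≤ 2 → ⊥
  too-few-parts (s≤s (s≤s _)) (s≤s (s≤s ()))

<-frac-glue : ∀ {κ cA cB c} tA tB p → (2 ≤ tA → κ < frac cA (tA ∸ 2)) → (2 ≤ tB → κ < frac cB (tB ∸ 2)) →
              cA + cB ≤ c → suc p ≤ tA + tB → 2 ≤ p → κ < frac c (p ∸ 2)
<-frac-glue (suc (suc a)) (suc (suc b)) p κ<A κ<B cA+cB≤c parts _ =
  <-frac-from p (<-mediant (κ<A 2≤2+) (κ<B 2≤2+)) cA+cB≤c
    (ℕ.≤-pred (subst (suc p ≤_) (cong (λ m → 2 + m) (trans (ℕ.+-suc a (suc b)) (cong suc (ℕ.+-suc a b)))) parts))
<-frac-glue {cA = cA} {cB} (suc (suc a)) zero p κ<A _ cA+cB≤c parts _ =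
  <-frac-from p (κ<A 2≤2+) (ℕ.≤-trans (ℕ.m≤m+n cA cB) cA+cB≤c) (ℕ.<⇒≤ (subst (suc p ≤_) (ℕ.+-identityʳ (2 + a)) parts))
<-frac-glue {cA = cA} {cB} (suc (suc a)) (suc zero) p κ<A _ cA+cB≤c parts _ =
  <-frac-from p (κ<A 2≤2+) (ℕ.≤-trans (ℕ.m≤m+n cA cB) cA+cB≤c) (ℕ.≤-pred (subst (suc p ≤_) (ℕ.+-comm (2 + a) 1) parts))
<-frac-glue {cA = cA} {cB} zero (suc (suc b)) p _ κ<B cA+cB≤c parts _ =
  <-frac-from p (κ<B 2≤2+) (ℕ.≤-trans (ℕ.m≤n+m cB cA) cA+cB≤c) (ℕ.m≤n⇒m≤1+n (ℕ.≤-pred parts))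
<-frac-glue {cA = cA} {cB} (suc zero) (suc (suc b)) p _ κ<B cA+cB≤c parts _ =
  <-frac-from p (κ<B 2≤2+) (ℕ.≤-trans (ℕ.m≤n+m cB cA) cA+cB≤c) (ℕ.≤-pred parts)
<-frac-glue zero zero p _ _ _ () _
<-frac-glue zero (suc zero) p _ _ _ parts p≥2 = ⊥-elim (too-few-parts p≥2 (ℕ.m≤n⇒m≤1+n parts))
<-frac-glue (suc zero) zero p _ _ _ parts p≥2 = ⊥-elim (too-few-parts p≥2 (ℕ.m≤n⇒m≤1+n parts))
<-frac-glue (suc zero) (suc zero) p _ _ _ parts p≥2 = ⊥-elim (too-few-parts p≥2 parts)

index-∈-lookup : ∀ {A : Set} (xs : List A) i → index (∈-lookup {xs = xs} i) ≡ i
index-∈-lookup (x ∷ xs) zero = refl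
index-∈-lookup (x ∷ xs) (suc i) = cong suc (index-∈-lookup xs i)

module Ranking {t} (xs : List (Fin t)) (xs! : Unique xs) (default : Fin (length xs)) where

  open DecMembership (_≟_ {n = t}) using () renaming (_∈?_ to _∈ₗ?_)

  rank : Fin t → Fin (length xs)
  rank i with i ∈ₗ? xs
  ... | yes i∈xs = index i∈xs
  ... | no _ = default

  rank-injective : ∀ {i j} → i ∈ₗ xs → j ∈ₗ xs → rank i ≡ rank j → i ≡ j
  rank-injective {i} {j} i∈xs j∈xs with i ∈ₗ? xs | j ∈ₗ? xs
  ... | yes i∈xs′ | yes j∈xs′ = index-injective (setoid _) i∈xs′ j∈xs′
  ... | no i∉xs | _ = contradiction i∈xs i∉xs
  ... | _ | no j∉xs = contradiction j∈xs j∉xs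

  rank-lookup : ∀ k → rank (lookup xs k) ≡ k
  rank-lookup k with lookup xs k ∈ₗ? xs
  ... | yes k∈xs = trans (cong index (∈-irrelevant k∈xs (∈-lookup k))) (index-∈-lookup xs k)
    where
    ∈-irrelevant : ∀ {i} (p q : i ∈ₗ xs) → p ≡ q
    ∈-irrelevant = unique⇒irrelevant (setoid _) (Decidable⇒UIP.≡-irrelevant _≟_) xs!
  ... | no k∉xs = contradiction (∈-lookup k) k∉xs

module Hypergraph {n : ℕ} {I : Set} (es : List I) (E : I → Subset n) where

  open Hyp es E

  Used : ∀ {t} → Subset n → (Fin n → Fin t) → Fin t → Set
  Used U g i = ∃ λ v → v ∈ U × g v ≡ i

  used? : ∀ {t} U (g : Fin n → Fin t) → Decidable (Used U g)
  used? U g i = any? (λ v → (v ∈? U) ×-dec (g v ≟ i))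

  partCount : ∀ {t} → Subset n → (Fin n → Fin t) → ℕ
  partCount {t} U g = count (used? U g) (allFin t)

  Splits : ∀ {t} → Subset n → (Fin n → Fin t) → Set
  Splits U g = 2 ≤ partCount U g

  -- crossings / (parts − 1); a junk value unless g splits U
  cutRatio : ∀ {t} → Subset n → (Fin n → Fin t) → ℚ
  cutRatio U g = frac (crossCount U g) (partCount U g ∸ 2)

  Crossing : ∀ {t} → Subset n → (Fin n → Fin t) → I → Set
  Crossing U g e = E e ⊆ U × ¬ SinglePart g e

  crossing? : ∀ {t} U (g : Fin n → Fin t) → Decidable (Crossing U g)
  crossing? U g e = (E e ⊆? U) ×-dec ¬? (singlePart? g e)

  module _ {t : ℕ} (W : Subset n) (f : Fin n → Fin t) {j : Fin t} {v : Fin n} where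

    ∈part⁺ : v ∈ W → f v ≡ j → v ∈ part W f j
    ∈part⁺ v∈W fv≡j = ∈-select⁺ (λ v → (v ∈? W) ×-dec (f v ≟ j)) (v∈W , fv≡j)

    ∈part⁻ : v ∈ part W f j → v ∈ W × f v ≡ j
    ∈part⁻ = ∈-select⁻ (λ v → (v ∈? W) ×-dec (f v ≟ j))

  opaque
    unfolding frac

    ratio≡frac : ∀ {k} U (f : Fin n → Fin (2 + k)) → ratio U f ≡ frac (crossCount U f) k
    ratio≡frac U f = refl

  module _ {t : ℕ} {g : Fin n → Fin t} {e : I} where

    singlePart-∘ : ∀ {t′} (m : Fin t → Fin t′) → SinglePart g e → SinglePart (m ∘ g) e
    singlePart-∘ m (i , g≡i) = m i , λ v v∈e → cong m (g≡i v v∈e)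

    crossing-∘ : ∀ {t′ U} (m : Fin t → Fin t′) → Crossing U (m ∘ g) e → Crossing U g e
    crossing-∘ m (e⊆U , ¬single) = e⊆U , ¬single ∘ singlePart-∘ m

    singlePart-elim : SinglePart g e → ∀ {u v} → u ∈ E e → v ∈ E e → g u ≡ g v
    singlePart-elim (i , g≡i) u∈e v∈e = trans (g≡i _ u∈e) (sym (g≡i _ v∈e))

    -- the label is only needed when E e is empty
    singlePart-intro : Fin t → (∀ {u v} → u ∈ E e → v ∈ E e → g u ≡ g v) → SinglePart g e
    singlePart-intro i constant with nonempty? (E e)
    ... | yes (u , u∈e) = g u , λ v v∈e → constant v∈e u∈e
    ... | no empty = i , λ v v∈e → contradiction (v , v∈e) empty

  crossCount-relabel : ∀ {t t′} U (g : Fin n → Fin t) (m : Fin t → Fin t′) → Fin t →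
                       (∀ {i j} → Used U g i → Used U g j → m i ≡ m j → i ≡ j) →
                       crossCount U (m ∘ g) ≡ crossCount U g
  crossCount-relabel U g m i₀ m-injective =
    count-≐ (crossing? U (m ∘ g)) (crossing? U g) (crossing-∘ m , still-crossing) es
    where
    still-crossing : ∀ {e} → Crossing U g e → Crossing U (m ∘ g) e
    still-crossing (e⊆U , ¬single) = e⊆U , λ single → ¬single (singlePart-intro i₀ λ u∈e v∈e →
      m-injective (_ , e⊆U u∈e , refl) (_ , e⊆U v∈e , refl) (singlePart-elim single u∈e v∈e))

  -- Attains only compares with labellings onto Fin (2 + k′), so labellings are first compressed.
  compress : ∀ {t d} U (g : Fin n → Fin t) → partCount U g ≡ 2 + d →
             ∃ λ (f : Fin n → Fin (2 + d)) → NonemptyParts U f × crossCount U f ≡ crossCount U g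
  compress {t} U g parts≡ = relabel parts≡ zero
    where
    labels : List (Fin t)
    labels = filter (used? U g) (allFin t)

    relabel : ∀ {N} → length labels ≡ N → Fin N →
              ∃ λ (f : Fin n → Fin N) → (∀ k → Used U f k) × crossCount U f ≡ crossCount U g
    relabel refl default = rank ∘ g , onto , crossCount-relabel U g rank (lookup labels default) injective
      where
      open Ranking labels (Unique.filter⁺ (used? U g) (Unique.allFin⁺ t)) default
      onto : ∀ k → Used U (rank ∘ g) k
      onto k with proj₂ (∈-filter⁻ (used? U g) {xs = allFin t} (∈-lookup k))
      ... | v , v∈U , gv≡ = v , v∈U , trans (cong rank gv≡) (rank-lookup k)
      injective : ∀ {i j} → Used U g i → Used U g j → rank i ≡ rank j → i ≡ j
      injective {i} {j} used-i used-j = rank-injective (∈-filter⁺ (used? U g) (∈-allFin i) used-i)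
                                                       (∈-filter⁺ (used? U g) (∈-allFin j) used-j)

  attains⇒≤cutRatio : ∀ {k W} {f : Fin n → Fin (2 + k)} → Attains W f →
                      ∀ {t} (g : Fin n → Fin t) → Splits W g → ratio W f ≤ℚ cutRatio W g
  attains⇒≤cutRatio {W = W} {f} attains g splits = bound (compress W g (sym (ℕ.m+[n∸m]≡n splits)))
    where
    bound : (∃ λ (f′ : Fin n → Fin (2 + (partCount W g ∸ 2))) →
               NonemptyParts W f′ × crossCount W f′ ≡ crossCount W g) → ratio W f ≤ℚ cutRatio W g
    bound (f′ , nonempty , cross≡) = begin
      ratio W f                                  ≤⟨ attains (partCount W g ∸ 2) f′ nonempty ⟩
      ratio W f′                                 ≡⟨ ratio≡frac W f′ ⟩
      frac (crossCount W f′) (partCount W g ∸ 2) ≡⟨ cong (λ c → frac c (partCount W g ∸ 2)) cross≡ ⟩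
      cutRatio W g                               ∎
      where open ℚ.≤-Reasoning

  module Merge {t} (A : Subset n) (g : Fin n → Fin t) (u : Fin n) where

    collapse : Fin t → Fin t
    collapse i with used? A g i
    ... | yes _ = g u
    ... | no _ = i

    merged : Fin n → Fin t
    merged = collapse ∘ g

    collapse-used : ∀ {i} → Used A g i → collapse i ≡ g u
    collapse-used {i} used with used? A g i
    ... | yes _ = refl
    ... | no unused = contradiction used unused

    collapse-unused : ∀ {i} → ¬ Used A g i → collapse i ≡ i
    collapse-unused {i} unused with used? A g i
    ... | yes used = contradiction used unused
    ... | no _ = refl

    crossCount-merged : ∀ {W Y} → A ⊆ Y → W ⊆ Y → crossCount A g + crossCount W merged ≤ crossCount Y g
    crossCount-merged {W} {Y} A⊆Y W⊆Y =
      count-disjoint (crossing? A g) (crossing? W merged) (crossing? Y g)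
        (λ (e⊆A , ¬single) → A⊆Y ∘ e⊆A , ¬single)
        (λ crossing → let e⊆W , ¬single = crossing-∘ collapse crossing in W⊆Y ∘ e⊆W , ¬single)
        (λ (e⊆A , _) (_ , ¬single) → ¬single (g u , λ v v∈e → collapse-used (v , e⊆A v∈e , refl)))
        es

    partCount-merged : ∀ {W} → u ∈ A → u ∈ W →
                       suc (count (used? W g ∩? ∁? (used? A g)) (allFin t)) ≤ partCount W merged
    partCount-merged {W} u∈A u∈W =
      count-mono-< (used? W g ∩? ∁? (used? A g)) (used? W merged)
        (λ ((v , v∈W , gv≡i) , unused) → v , v∈W , trans (cong collapse gv≡i) (collapse-unused unused))
        (∈-allFin (g u)) (u , u∈W , collapse-used (u , u∈A , refl)) (λ (_ , unused) → unused (u , u∈A , refl))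

  -- Merging the parts of f that meet U yields a partition of W that has lost at least the crossings
  -- inside U but kept all other parts; the optimality of f then bounds the cut ratio of U.
  cutRatio≤ratio : ∀ {k W U} {f : Fin n → Fin (2 + k)} → NonemptyParts W f → Attains W f →
                   U ⊆ W → Splits U f → cutRatio U f ≤ℚ ratio W f
  cutRatio≤ratio {k} {W} {U} {f} nonempty attains U⊆W splits =
    subst (cutRatio U f ≤ℚ_) (sym (ratio≡frac W f))
      (frac-≤ (coarsening-bound {crossCount U f} {crossCount W merged} {crossCount W f} {k}
                 (partCount W merged) (partCount U f) (crossCount-merged U⊆W id) optimal parts-bound splits))
    where
    some-used : ∃ (Used U f)
    some-used = count>0⇒∃ (used? U f) (allFin (2 + k)) (ℕ.≤-trans (s≤s z≤n) splits)
    u : Fin n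
    u = proj₁ (proj₂ some-used)
    u∈U : u ∈ U
    u∈U = proj₁ (proj₂ (proj₂ some-used))
    open Merge U f u
    optimal : Splits W merged → crossCount W f * suc (partCount W merged ∸ 2) ≤ crossCount W merged * suc k
    optimal splits′ = frac-≤⁻ (subst (_≤ℚ cutRatio W merged) (ratio≡frac W f) (attains⇒≤cutRatio attains merged splits′))
    unused : ℕ
    unused = count (∁? (used? U f)) (allFin (2 + k))
    unused≤ : unused ≤ count (used? W f ∩? ∁? (used? U f)) (allFin (2 + k))
    unused≤ = count-mono (∁? (used? U f)) (used? W f ∩? ∁? (used? U f)) (λ {i} unused-i → nonempty i , unused-i) (allFin (2 + k))
    merged-parts : suc (count (used? W f ∩? ∁? (used? U f)) (allFin (2 + k))) ≤ partCount W merged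
    merged-parts = partCount-merged u∈U (U⊆W u∈U)
    parts-bound : 3 + k ≤ partCount U f + partCount W merged
    parts-bound = begin
      3 + k                                ≡⟨ cong suc (count+count∁-allFin (used? U f)) ⟨
      suc (partCount U f + unused)         ≡⟨ ℕ.+-suc (partCount U f) unused ⟨
      partCount U f + suc unused           ≤⟨ ℕ.+-monoʳ-≤ (partCount U f) (ℕ.≤-trans (s≤s unused≤) merged-parts) ⟩
      partCount U f + partCount W merged   ∎
      where open ℕ.≤-Reasoning

  module Refine {t th} (f : Fin n → Fin t) (j : Fin t) (h : Fin n → Fin th) where

    refined : Fin n → Fin (th + t)
    refined v with f v ≟ j
    ... | yes _ = h v ↑ˡ t
    ... | no _ = th ↑ʳ f v

    refined-inside : ∀ {v} → f v ≡ j → refined v ≡ h v ↑ˡ t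
    refined-inside {v} fv≡j with f v ≟ j
    ... | yes _ = refl
    ... | no fv≢j = contradiction fv≡j fv≢j

    refined-outside : ∀ {v} → f v ≢ j → refined v ≡ th ↑ʳ f v
    refined-outside {v} fv≢j with f v ≟ j
    ... | yes fv≡j = contradiction fv≡j fv≢j
    ... | no _ = refl

    crossing-refined : ∀ {W e} → Crossing W refined e → Crossing W f e ⊎ Crossing (part W f j) h e
    crossing-refined {W} {e} (e⊆W , ¬single) with singlePart? f e
    ... | no ¬single-f = inj₁ (e⊆W , ¬single-f)
    ... | yes (i , f≡i) with i ≟ j
    ...   | no i≢j = contradiction (th ↑ʳ i , λ v v∈e →
              trans (refined-outside (i≢j ∘ trans (sym (f≡i v v∈e)))) (cong (th ↑ʳ_) (f≡i v v∈e))) ¬single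
    ...   | yes refl = inj₂ ((λ v∈e → ∈part⁺ W f (e⊆W v∈e) (f≡i _ v∈e)) , λ (l , h≡l) →
              ¬single (l ↑ˡ t , λ v v∈e → trans (refined-inside (f≡i v v∈e)) (cong (_↑ˡ t) (h≡l v v∈e))))

  -- Refining part j of f by h yields a partition of W whose extra crossings are those of h;
  -- the optimality of f then bounds the cut ratio of h.
  ratio≤cutRatio : ∀ {k W th} {f : Fin n → Fin (2 + k)} → NonemptyParts W f → Attains W f →
                   ∀ j (h : Fin n → Fin th) → Splits (part W f j) h → ratio W f ≤ℚ cutRatio (part W f j) h
  ratio≤cutRatio {k} {W} {th} {f} nonempty attains j h splits =
    subst (_≤ℚ cutRatio Wj h) (sym (ratio≡frac W f))
      (frac-≤ (refinement-bound {crossCount W f} {crossCount W refined} {crossCount Wj h} {k}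
                 (partCount W refined) (partCount Wj h) optimal crossing-cover parts-bound splits))
    where
    open Refine f j h
    Wj : Subset n
    Wj = part W f j
    used-inside : ∀ i → Used Wj h i → Used W refined (i ↑ˡ (2 + k))
    used-inside i (v , v∈Wj , hv≡i) =
      let v∈W , fv≡j = ∈part⁻ W f v∈Wj in v , v∈W , trans (refined-inside fv≡j) (cong (_↑ˡ (2 + k)) hv≡i)
    used-outside : ∀ i → i ≢ j → Used W refined (th ↑ʳ i)
    used-outside i i≢j =
      let v , v∈W , fv≡i = nonempty i in v , v∈W , trans (refined-outside (i≢j ∘ trans (sym fv≡i))) (cong (th ↑ʳ_) fv≡i)
    parts-bound : partCount Wj h + suc k ≤ partCount W refined
    parts-bound = begin
      partCount Wj h + suc k                          ≤⟨ ℕ.+-monoʳ-≤ (partCount Wj h) (count-≢ j) ⟩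
      partCount Wj h + count (∁? (_≟ j)) (allFin _)   ≤⟨ ℕ.+-mono-≤
                                                           (count-tabulate-mono (used? Wj h) (used? W refined) id (_↑ˡ (2 + k)) used-inside)
                                                           (count-tabulate-mono (∁? (_≟ j)) (used? W refined) id (th ↑ʳ_) used-outside) ⟩
      count (used? W refined) (tabulate (_↑ˡ (2 + k))) + count (used? W refined) (tabulate (th ↑ʳ_))
                                                      ≡⟨ count-tabulate-+ (used? W refined) th id ⟨
      partCount W refined                             ∎
      where open ℕ.≤-Reasoning
    optimal : crossCount W f * suc (partCount W refined ∸ 2) ≤ crossCount W refined * suc k
    optimal = frac-≤⁻ (subst (_≤ℚ cutRatio W refined) (ratio≡frac W f)
                (attains⇒≤cutRatio attains refined (ℕ.≤-trans splits (ℕ.≤-trans (ℕ.m≤m+n _ _) parts-bound))))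
    crossing-cover : crossCount W refined ≤ crossCount W f + crossCount Wj h
    crossing-cover = count-cover (crossing? W refined) (crossing? W f) (crossing? Wj h) crossing-refined es

  Φ[_]≤_ : Subset n → ℚ → Set
  Φ[ U ]≤ q = ∃ λ t → Σ (Fin n → Fin t) λ g → Splits U g × cutRatio U g ≤ℚ q

  Φ[_]≥_ : Subset n → ℚ → Set
  Φ[ X ]≥ q = ∀ {t} (g : Fin n → Fin t) → Splits X g → q ≤ℚ cutRatio X g

  two-parts : ∀ {t U W} {f : Fin n → Fin (suc t)} → U ⊆ W → (∀ j → ¬ (U ⊆ part W f j)) → Splits U f
  two-parts {U = U} {W} {f} U⊆W ¬inside =
    let u , u∈U , _ = ⊈⇒∃∉ (¬inside zero)
        v , v∈U , v∉part = ⊈⇒∃∉ (¬inside (f u))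
    in count-≥2 (used? U f) (∈-allFin (f u)) (∈-allFin (f v))
         (λ fu≡fv → v∉part (∈part⁺ W f (U⊆W v∈U) (sym fu≡fv))) (u , u∈U , refl) (v , v∈U , refl)

  mutual
    strength-≥Φ : ∀ {s W} → StrengthOn s W → ∀ {e} → e ∈ₗ es → ∀ {U} → E e ⊆ U → U ⊆ W → Φ[ U ]≤ s e
    strength-≥Φ (leaf none) e∈es e⊆U U⊆W = ⊥-elim (none _ e∈es (U⊆W ∘ e⊆U))
    strength-≥Φ {s} {W} (node k f nonempty attains crossing≡ sub) {e} e∈es {U} e⊆U U⊆W =
      cases (any? (λ j → U ⊆? part W f j))
      where
      cases : Dec (∃ λ j → U ⊆ part W f j) → Φ[ U ]≤ s e
      cases (yes (j , U⊆Wj)) = strength-≥Φ (sub j) e∈es e⊆U U⊆Wj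
      cases (no ¬inside) = _ , f , splits , ℚ.≤-trans (cutRatio≤ratio nonempty attains U⊆W splits)
                                              (ratio≤strength nonempty attains crossing≡ sub e∈es (U⊆W ∘ e⊆U))
        where
        splits : Splits U f
        splits = two-parts U⊆W (λ j U⊆Wj → ¬inside (j , U⊆Wj))

    ratio≤strength : ∀ {s W k} {f : Fin n → Fin (2 + k)} → NonemptyParts W f → Attains W f →
                     (∀ e → e ∈ₗ es → E e ⊆ W → ¬ SinglePart f e → s e ≡ ratio W f) →
                     (∀ j → StrengthOn s (part W f j)) → ∀ {e} → e ∈ₗ es → E e ⊆ W → ratio W f ≤ℚ s e
    ratio≤strength {s} {W} {f = f} nonempty attains crossing≡ sub {e} e∈es e⊆W = cases (singlePart? f e)
      where
      cases : Dec (SinglePart f e) → ratio W f ≤ℚ s e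
      cases (no ¬single) = ℚ.≤-reflexive (sym (crossing≡ e e∈es e⊆W ¬single))
      cases (yes (j , f≡j)) =
        let _ , g , splits , cut≤s = strength-≥Φ (sub j) e∈es (λ v∈e → ∈part⁺ W f (e⊆W v∈e) (f≡j _ v∈e)) id
        in ℚ.≤-trans (ratio≤cutRatio nonempty attains j g splits) cut≤s

  strength-≤Φ : ∀ {s W} → StrengthOn s W → ∀ {e} → e ∈ₗ es → E e ⊆ W → ∃ λ X → E e ⊆ X × Φ[ X ]≥ s e
  strength-≤Φ (leaf none) e∈es e⊆W = ⊥-elim (none _ e∈es e⊆W)
  strength-≤Φ {s} {W} (node k f nonempty attains crossing≡ sub) {e} e∈es e⊆W = cases (singlePart? f e)
    where
    cases : Dec (SinglePart f e) → ∃ λ X → E e ⊆ X × Φ[ X ]≥ s e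
    cases (yes (j , f≡j)) = strength-≤Φ (sub j) e∈es (λ v∈e → ∈part⁺ W f (e⊆W v∈e) (f≡j _ v∈e))
    cases (no ¬single) = W , e⊆W , λ g splits →
      subst (_≤ℚ cutRatio W g) (sym (crossing≡ e e∈es e⊆W ¬single)) (attains⇒≤cutRatio attains g splits)

  Φ[_]>_ : Subset n → ℚ → Set
  Φ[ X ]> κ = ∀ {t} (g : Fin n → Fin t) → Splits X g → κ < cutRatio X g

  <strength⇔Φ> : ∀ {s κ e} → IsStrength s → e ∈ₗ es → κ < s e ⇔ (∃ λ X → E e ⊆ X × Φ[ X ]> κ)
  <strength⇔Φ> {s} {κ} {e} strength e∈es = mk⇔ to from
    where
    to : κ < s e → ∃ λ X → E e ⊆ X × Φ[ X ]> κ
    to κ<s = let X , e⊆X , Φ≥s = strength-≤Φ strength e∈es (λ _ → ∈⊤) in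
             X , e⊆X , λ g splits → ℚ.<-≤-trans κ<s (Φ≥s g splits)
    from : (∃ λ X → E e ⊆ X × Φ[ X ]> κ) → κ < s e
    from (X , e⊆X , Φ>κ) = let _ , g , splits , cut≤s = strength-≥Φ strength e∈es e⊆X (λ _ → ∈⊤) in
                           ℚ.<-≤-trans (Φ>κ g splits) cut≤s

  Φ>-⁅⁆ : ∀ {κ} u → Φ[ ⁅ u ⁆ ]> κ
  Φ>-⁅⁆ u {t} g splits = contradiction splits (ℕ.<⇒≱ (s≤s (count-≤1 (used? ⁅ u ⁆ g) same-label (Unique.allFin⁺ t))))
    where
    same-label : ∀ {i i′} → Used ⁅ u ⁆ g i → Used ⁅ u ⁆ g i′ → i ≡ i′
    same-label (v , v∈ , gv≡i) (v′ , v′∈ , gv′≡i′) =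
      trans (sym gv≡i) (trans (cong g (trans (x∈⁅y⁆⇒x≡y u v∈) (sym (x∈⁅y⁆⇒x≡y u v′∈)))) gv′≡i′)

  Collapses : ∀ {t} → (Fin n → Fin n → Set) → Subset n → (Fin n → Fin t) → Set
  Collapses R X g = ∀ {u v} → u ∈ X → v ∈ X → R u v → g u ≡ g v

  Φ[_]>_modulo_ : Subset n → ℚ → (Fin n → Fin n → Set) → Set
  Φ[ X ]> κ modulo R = ∀ {t} (g : Fin n → Fin t) → Collapses R X g → Splits X g → κ < cutRatio X g

  used-∪ : ∀ {t A B} {g : Fin n → Fin t} {i} → Used (A ∪ B) g i → Used A g i ⊎ (Used B g i × ¬ Used A g i)
  used-∪ {A = A} {B} {g} {i} (v , v∈A∪B , gv≡i) with used? A g i | x∈p∪q⁻ A B v∈A∪B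
  ... | yes usedA | _ = inj₁ usedA
  ... | no unusedA | inj₁ v∈A = contradiction (v , v∈A , gv≡i) unusedA
  ... | no unusedA | inj₂ v∈B = inj₂ ((v , v∈B , gv≡i) , unusedA)

  Φ>-∪-modulo : ∀ {κ R A B w} → Φ[ A ]> κ → Φ[ B ]> κ modulo (λ u v → R u v ⊎ (u ∈ A × v ∈ A)) →
         w ∈ A → w ∈ B → Φ[ A ∪ B ]> κ modulo R
  Φ>-∪-modulo {κ} {R} {A} {B} {w} Φ[A]>κ Φ[B]>κ w∈A w∈B {t} g collapses splits =
    <-frac-glue (partCount A g) (partCount B merged) (partCount (A ∪ B) g)
      (Φ[A]>κ g) (Φ[B]>κ merged merged-collapses) (crossCount-merged (p⊆p∪q B) (q⊆p∪q A B)) parts-bound splits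
    where
    open Merge A g w
    merged-collapses : Collapses (λ u v → R u v ⊎ (u ∈ A × v ∈ A)) B merged
    merged-collapses u∈B v∈B (inj₁ Ruv) = cong collapse (collapses (q⊆p∪q A B u∈B) (q⊆p∪q A B v∈B) Ruv)
    merged-collapses _ _ (inj₂ (u∈A , v∈A)) = trans (collapse-used (_ , u∈A , refl)) (sym (collapse-used (_ , v∈A , refl)))
    fresh : ℕ
    fresh = count (used? B g ∩? ∁? (used? A g)) (allFin t)
    used-bound : partCount (A ∪ B) g ≤ partCount A g + fresh
    used-bound = count-cover (used? (A ∪ B) g) (used? A g) (used? B g ∩? ∁? (used? A g)) used-∪ (allFin t)
    parts-bound : suc (partCount (A ∪ B) g) ≤ partCount A g + partCount B merged
    parts-bound = begin
      suc (partCount (A ∪ B) g)     ≤⟨ s≤s used-bound ⟩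
      suc (partCount A g + fresh)   ≡⟨ ℕ.+-suc (partCount A g) fresh ⟨
      partCount A g + suc fresh     ≤⟨ ℕ.+-monoʳ-≤ (partCount A g) (partCount-merged w∈A w∈B) ⟩
      partCount A g + partCount B merged ∎
      where open ℕ.≤-Reasoning

  Φ>-∪ : ∀ {κ A B w} → Φ[ A ]> κ → Φ[ B ]> κ → w ∈ A → w ∈ B → Φ[ A ∪ B ]> κ
  Φ>-∪ Φ[A]>κ Φ[B]>κ w∈A w∈B g =
    Φ>-∪-modulo {R = λ _ _ → ⊥} Φ[A]>κ (λ g _ → Φ[B]>κ g) w∈A w∈B g (λ _ _ ())

  Φ>-modulo-mono : ∀ {κ R R′ X} → (∀ {u v} → u ∈ X → v ∈ X → R u v → R′ u v) →
                   Φ[ X ]> κ modulo R → Φ[ X ]> κ modulo R′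
  Φ>-modulo-mono R⇒R′ Φ>κ g collapses = Φ>κ g (λ u∈X v∈X Ruv → collapses u∈X v∈X (R⇒R′ u∈X v∈X Ruv))

module Contraction {n m k} (E : Fin m → Subset n) (p : Fin n → Fin k) (onto : ∀ i → ∃ λ v → p v ≡ i) where

  module H = Hypergraph (allFin m) E
  module C = Hypergraph (contractEdges p E) (contractEdge p E)
  open Hyp (allFin m) E using (crossCount; SinglePart; singlePart?)
  open Hyp (contractEdges p E) (contractEdge p E) using () renaming (crossCount to crossCount′; SinglePart to SinglePart′)

  module _ {v : Fin n} {i : Fin k} where

    ∈block⁺ : p v ≡ i → v ∈ block p i
    ∈block⁺ = ∈-select⁺ (λ v → p v ≟ i)

    ∈block⁻ : v ∈ block p i → p v ≡ i
    ∈block⁻ = ∈-select⁻ (λ v → p v ≟ i)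

  module _ {e : Fin m} where

    ∈contractEdge⁺ : ∀ {v} → v ∈ E e → p v ∈ contractEdge p E e
    ∈contractEdge⁺ {v} v∈e = ∈-select⁺ (λ i → any? (λ v → (v ∈? E e) ×-dec (p v ≟ i))) (v , v∈e , refl)

    ∈contractEdge⁻ : ∀ {i} → i ∈ contractEdge p E e → ∃ λ v → v ∈ E e × p v ≡ i
    ∈contractEdge⁻ = ∈-select⁻ (λ i → any? (λ v → (v ∈? E e) ×-dec (p v ≟ i)))

    ∈contractEdges : ¬ InBlock p E e → e ∈ₗ contractEdges p E
    ∈contractEdges = ∈-filter⁺ (λ e → ¬? (inBlock? p E e)) (∈-allFin e)

  module Transfer {Z : Subset n} {X : Subset k} (into : ∀ {v} → v ∈ Z → p v ∈ X) (back : ∀ {v} → p v ∈ X → v ∈ Z)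
                  {t} (g : Fin n → Fin t) (g′ : Fin k → Fin t) (factors : ∀ {v} → v ∈ Z → g v ≡ g′ (p v)) where

    partCount-contract : H.partCount Z g ≡ C.partCount X g′
    partCount-contract = count-≐ (H.used? Z g) (C.used? X g′) (to , from) (allFin t)
      where
      to : ∀ {i} → H.Used Z g i → C.Used X g′ i
      to (v , v∈Z , gv≡i) = p v , into v∈Z , trans (sym (factors v∈Z)) gv≡i
      from : ∀ {i} → C.Used X g′ i → H.Used Z g i
      from (a , a∈X , g′a≡i) =
        let v , pv≡a = onto a
            v∈Z = back (subst (_∈ X) (sym pv≡a) a∈X)
        in v , v∈Z , trans (factors v∈Z) (trans (cong g′ pv≡a) g′a≡i)

    crossCount-contract : crossCount Z g ≡ crossCount′ X g′
    crossCount-contract =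
      trans (count-≐ (H.crossing? Z g) (notInBlock? ∩? C.crossing? X g′) (to , from) (allFin m))
            (sym (count-filter notInBlock? (C.crossing? X g′) (allFin m)))
      where
      notInBlock? : Decidable (λ e → ¬ InBlock p E e)
      notInBlock? e = ¬? (inBlock? p E e)
      to : ∀ {e} → H.Crossing Z g e → ¬ InBlock p E e × C.Crossing X g′ e
      to {e} (e⊆Z , ¬single) = not-in-block , contracted⊆X , ¬single′
        where
        not-in-block : ¬ InBlock p E e
        not-in-block (i , e⊆block) =
          ¬single (g′ i , λ v v∈e → trans (factors (e⊆Z v∈e)) (cong g′ (∈block⁻ (e⊆block v∈e))))
        contracted⊆X : contractEdge p E e ⊆ X
        contracted⊆X a∈ = let v , v∈e , pv≡a = ∈contractEdge⁻ a∈ in subst (_∈ X) pv≡a (into (e⊆Z v∈e))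
        ¬single′ : ¬ SinglePart′ g′ e
        ¬single′ (l , g′≡l) = ¬single (l , λ v v∈e → trans (factors (e⊆Z v∈e)) (g′≡l (p v) (∈contractEdge⁺ v∈e)))
      from : ∀ {e} → ¬ InBlock p E e × C.Crossing X g′ e → H.Crossing Z g e
      from {e} (_ , contracted⊆X , ¬single′) = e⊆Z , ¬single
        where
        e⊆Z : E e ⊆ Z
        e⊆Z v∈e = back (contracted⊆X (∈contractEdge⁺ v∈e))
        ¬single : ¬ SinglePart g e
        ¬single (l , g≡l) = ¬single′ (l , λ a a∈ → let v , v∈e , pv≡a = ∈contractEdge⁻ a∈ in
          trans (cong g′ (sym pv≡a)) (trans (sym (factors (e⊆Z v∈e))) (g≡l v v∈e)))

    cutRatio-contract : H.cutRatio Z g ≡ C.cutRatio X g′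
    cutRatio-contract = cong₂ (λ c r → frac c (r ∸ 2)) crossCount-contract partCount-contract

  SameBlock : Fin n → Fin n → Set
  SameBlock u v = p u ≡ p v

  preimage : Subset k → Subset n
  preimage X = select (λ v → p v ∈? X)

  module _ {X : Subset k} {v : Fin n} where

    ∈preimage⁺ : p v ∈ X → v ∈ preimage X
    ∈preimage⁺ = ∈-select⁺ (λ v → p v ∈? X)

    ∈preimage⁻ : v ∈ preimage X → p v ∈ X
    ∈preimage⁻ = ∈-select⁻ (λ v → p v ∈? X)

  Φ>-preimage : ∀ {κ X} → C.Φ[ X ]> κ → H.Φ[ preimage X ]> κ modulo SameBlock
  Φ>-preimage {κ} {X} Φ>κ g collapses splits =
    subst (κ <_) (sym cutRatio-contract) (Φ>κ (g ∘ rep) (subst (2 ≤_) partCount-contract splits))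
    where
    rep : Fin k → Fin n
    rep i = proj₁ (onto i)
    factors : ∀ {v} → v ∈ preimage X → g v ≡ g (rep (p v))
    factors {v} v∈ = let p[rep]≡pv = proj₂ (onto (p v)) in
      collapses v∈ (∈preimage⁺ (subst (_∈ X) (sym p[rep]≡pv) (∈preimage⁻ v∈))) (sym p[rep]≡pv)
    open Transfer ∈preimage⁻ ∈preimage⁺ g (g ∘ rep) factors

  image : Subset n → Subset k
  image Y = select (λ i → any? (λ v → (v ∈? Y) ×-dec (p v ≟ i)))

  module _ {Y : Subset n} {i : Fin k} where

    ∈image⁺ : ∀ {v} → v ∈ Y → p v ≡ i → i ∈ image Y
    ∈image⁺ {v} v∈Y pv≡i = ∈-select⁺ (λ i → any? (λ v → (v ∈? Y) ×-dec (p v ≟ i))) (v , v∈Y , pv≡i)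

    ∈image⁻ : i ∈ image Y → ∃ λ v → v ∈ Y × p v ≡ i
    ∈image⁻ = ∈-select⁻ (λ i → any? (λ v → (v ∈? Y) ×-dec (p v ≟ i)))

  edge⊆preimage : ∀ {e X} → contractEdge p E e ⊆ X → E e ⊆ preimage X
  edge⊆preimage e′⊆X v∈e = ∈preimage⁺ (e′⊆X (∈contractEdge⁺ v∈e))

  Saturated : Subset n → Set
  Saturated Y = ∀ {u v} → p u ≡ p v → u ∈ Y → v ∈ Y

  Φ>-image : ∀ {κ Y} → H.Φ[ Y ]> κ → Saturated Y → C.Φ[ image Y ]> κ
  Φ>-image {κ} {Y} Φ>κ saturated g′ splits =
    subst (κ <_) cutRatio-contract (Φ>κ (g′ ∘ p) (subst (2 ≤_) (sym partCount-contract) splits))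
    where
    back : ∀ {v} → p v ∈ image Y → v ∈ Y
    back pv∈ = let u , u∈Y , pu≡pv = ∈image⁻ pv∈ in saturated pu≡pv u∈Y
    open Transfer (λ v∈Y → ∈image⁺ v∈Y refl) back (g′ ∘ p) g′ (λ _ → refl)

  contractEdge⊆image : ∀ {e Y} → E e ⊆ Y → contractEdge p E e ⊆ image Y
  contractEdge⊆image e⊆Y i∈ = let v , v∈e , pv≡i = ∈contractEdge⁻ i∈ in ∈image⁺ (e⊆Y v∈e) pv≡i

  -- S grows inside V_i from a single vertex: connectivity provides a hyperedge leaving S, and its
  -- strength > κ provides a set around it with Φ > κ.
  block-Φ> : ∀ {κ s} → Hyp.IsStrength (allFin m) E s → (∀ i → Hyp.Connected (allFin m) E (block p i)) →
             (∀ i e → E e ⊆ block p i → κ < s e) → ∀ i → ∃ λ Y → block p i ⊆ Y × H.Φ[ Y ]> κ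
  block-Φ> {κ} {s} strength connected strong i =
    let S , (_ , _ , Y , S⊆Y , Φ[Y]>κ) , B⊆S = grow Covered (B ⊆_) (B ⊆?_) extend start
    in Y , S⊆Y ∘ B⊆S , Φ[Y]>κ
    where
    B : Subset n
    B = block p i
    Covered : Subset n → Set
    Covered S = S ⊆ B × Nonempty S × ∃ λ Y → S ⊆ Y × H.Φ[ Y ]> κ
    start : Covered ⁅ proj₁ (onto i) ⁆
    start = let v , pv≡i = onto i in
      (λ u∈ → ∈block⁺ (subst (λ u → p u ≡ i) (sym (x∈⁅y⁆⇒x≡y v u∈)) pv≡i)) ,
      (v , x∈⁅x⁆ v) , ⁅ v ⁆ , id , H.Φ>-⁅⁆ v
    Bridge : Subset n → Fin m → Set
    Bridge S d = E d ⊆ B × Nonempty (S ∩ E d) × Nonempty ((B ─ S) ∩ E d)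
    extend : ∀ {S} → Covered S → ¬ (B ⊆ S) → ∃ λ S′ → S ⊂ S′ × Covered S′
    extend {S} (S⊆B , S≠∅ , Y , S⊆Y , Φ[Y]>κ) B⊈S =
      cross (any? (λ d → (E d ⊆? B) ×-dec (nonempty? (S ∩ E d) ×-dec nonempty? ((B ─ S) ∩ E d))))
      where
      cross : Dec (∃ (Bridge S)) → ∃ λ S′ → S ⊂ S′ × Covered S′
      cross (no none) = let w , w∈B , w∉S = ⊈⇒∃∉ B⊈S in
        ⊥-elim (connected i (S , S⊆B , S≠∅ , (w , x∈p∧x∉q⇒x∈p─q w∈B w∉S) ,
                             λ d _ d⊆B meets → none (d , d⊆B , meets)))
      cross (yes (d , d⊆B , (x , x∈S∩d) , (y , y∈rest∩d))) =
        let X , d⊆X , Φ[X]>κ = Equivalence.to (H.<strength⇔Φ> strength (∈-allFin d)) (strong i d d⊆B)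
            x∈S , x∈d = x∈p∩q⁻ S (E d) x∈S∩d
            y∈rest , y∈d = x∈p∩q⁻ (B ─ S) (E d) y∈rest∩d
        in S ∪ E d , (p⊆p∪q (E d) , y , q⊆p∪q S (E d) y∈d , x∈p─q⇒x∉q y∈rest) ,
           (λ z∈ → [ S⊆B , d⊆B ] (x∈p∪q⁻ S (E d) z∈)) , (x , p⊆p∪q (E d) x∈S) ,
           X ∪ Y , (λ z∈ → [ q⊆p∪q X Y ∘ S⊆Y , p⊆p∪q Y ∘ d⊆X ] (x∈p∪q⁻ S (E d) z∈)) ,
           H.Φ>-∪ Φ[X]>κ Φ[Y]>κ (d⊆X x∈d) (S⊆Y x∈S)

  module Blocks {κ s s′} (strength : Hyp.IsStrength (allFin m) E s)
                (strength′ : Hyp.IsStrength (contractEdges p E) (contractEdge p E) s′)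
                (block-Φ>κ : ∀ i → ∃ λ Y → block p i ⊆ Y × H.Φ[ Y ]> κ) where

    SameBlockIn : List (Fin k) → Fin n → Fin n → Set
    SameBlockIn is u v = p u ≡ p v × p u ∈ₗ is

    -- the blocks listed in `is` are still to be absorbed
    absorb-blocks : ∀ is {W} → H.Φ[ W ]> κ modulo SameBlockIn is → ∃ λ W′ → W ⊆ W′ × H.Φ[ W′ ]> κ
    absorb-blocks [] {W} Φ>κ = W , id , λ g → Φ>κ g (λ _ _ ())
    absorb-blocks (i ∷ is) {W} Φ>κ = absorb-block-i (any? (λ v → (v ∈? W) ×-dec (p v ≟ i))) (block-Φ>κ i)
      where
      absorb-block-i : Dec (∃ λ v → v ∈ W × p v ≡ i) → (∃ λ Y → block p i ⊆ Y × H.Φ[ Y ]> κ) →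
                       ∃ λ W′ → W ⊆ W′ × H.Φ[ W′ ]> κ
      absorb-block-i (no disjoint) _ = absorb-blocks is (H.Φ>-modulo-mono forget-i Φ>κ)
        where
        forget-i : ∀ {u v} → u ∈ W → v ∈ W → SameBlockIn (i ∷ is) u v → SameBlockIn is u v
        forget-i u∈W _ (_ , here pu≡i) = ⊥-elim (disjoint (_ , u∈W , pu≡i))
        forget-i _ _ (pu≡pv , there pu∈is) = pu≡pv , pu∈is
      absorb-block-i (yes (w , w∈W , pw≡i)) (Y , block⊆Y , Φ[Y]>κ) =
        let W′ , Y∪W⊆W′ , Φ[W′]>κ = absorb-blocks is
              (H.Φ>-∪-modulo Φ[Y]>κ (H.Φ>-modulo-mono inside-Y Φ>κ) (block⊆Y (∈block⁺ pw≡i)) w∈W)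
        in W′ , Y∪W⊆W′ ∘ q⊆p∪q Y W , Φ[W′]>κ
        where
        inside-Y : ∀ {u v} → u ∈ W → v ∈ W → SameBlockIn (i ∷ is) u v → SameBlockIn is u v ⊎ (u ∈ Y × v ∈ Y)
        inside-Y _ _ (pu≡pv , here pu≡i) = inj₂ (block⊆Y (∈block⁺ pu≡i) , block⊆Y (∈block⁺ (trans (sym pu≡pv) pu≡i)))
        inside-Y _ _ (pu≡pv , there pu∈is) = inj₁ (pu≡pv , pu∈is)

    absorb : ∀ {W} → H.Φ[ W ]> κ modulo SameBlock → ∃ λ W′ → W ⊆ W′ × H.Φ[ W′ ]> κ
    absorb = absorb-blocks (allFin k) ∘ H.Φ>-modulo-mono (λ {u} _ _ pu≡pv → pu≡pv , ∈-allFin (p u))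

    Leak : Subset n → Set
    Leak Y = ∃ λ u → ∃ λ v → p u ≡ p v × u ∈ Y × v ∉ Y

    saturate : ∀ {X} → H.Φ[ X ]> κ → ∃ λ X* → X ⊆ X* × H.Φ[ X* ]> κ × Saturated X*
    saturate {X} Φ[X]>κ =
      let X* , (X⊆X* , Φ[X*]>κ) , tight = grow Grown (¬_ ∘ Leak) (¬? ∘ leak?) add-block (id , Φ[X]>κ)
      in X* , X⊆X* , Φ[X*]>κ ,
         λ {u} {v} pu≡pv u∈X* → decidable-stable (v ∈? X*) (λ v∉X* → tight (u , v , pu≡pv , u∈X* , v∉X*))
      where
      Grown : Subset n → Set
      Grown Y = X ⊆ Y × H.Φ[ Y ]> κ
      leak? : Decidable Leak
      leak? Y = any? (λ u → any? (λ v → (p u ≟ p v) ×-dec (u ∈? Y) ×-dec ¬? (v ∈? Y)))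
      add-block : ∀ {Y} → Grown Y → ¬ ¬ Leak Y → ∃ λ Y′ → Y ⊂ Y′ × Grown Y′
      add-block {Y} (X⊆Y , Φ[Y]>κ) leaks =
        let u , v , pu≡pv , u∈Y , v∉Y = decidable-stable (leak? Y) leaks
            Z , block⊆Z , Φ[Z]>κ = block-Φ>κ (p u)
        in Z ∪ Y , (q⊆p∪q Z Y , v , p⊆p∪q Y (block⊆Z (∈block⁺ (sym pu≡pv))) , v∉Y) ,
           q⊆p∪q Z Y ∘ X⊆Y , H.Φ>-∪ Φ[Z]>κ Φ[Y]>κ (block⊆Z (∈block⁺ refl)) u∈Y

    <strength⇔<contracted : ∀ {e} → ¬ InBlock p E e → κ < s e ⇔ κ < s′ e
    <strength⇔<contracted {e} not-in-block = mk⇔ to from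
      where
      to : κ < s e → κ < s′ e
      to κ<s = let X , e⊆X , Φ[X]>κ = Equivalence.to (H.<strength⇔Φ> strength (∈-allFin e)) κ<s
                   X* , X⊆X* , Φ[X*]>κ , saturated = saturate Φ[X]>κ
               in Equivalence.from (C.<strength⇔Φ> strength′ (∈contractEdges not-in-block))
                    (image X* , contractEdge⊆image (X⊆X* ∘ e⊆X) , Φ>-image Φ[X*]>κ saturated)
      from : κ < s′ e → κ < s e
      from κ<s′ = let X , e⊆X , Φ[X]>κ = Equivalence.to (C.<strength⇔Φ> strength′ (∈contractEdges not-in-block)) κ<s′
                      W , preimage⊆W , Φ[W]>κ = absorb (Φ>-preimage Φ[X]>κ)
                  in Equivalence.from (H.<strength⇔Φ> strength (∈-allFin e)) (W , preimage⊆W ∘ edge⊆preimage e⊆X , Φ[W]>κ)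

mainTheorem12 : ∀ {n m k : ℕ} (E : Fin m → Subset n) →
  (∀ e → 2 ≤ ∣ E e ∣) →
  (κ : ℚ) (p : Fin n → Fin k) →
  (∀ i → ∃ λ v → p v ≡ i) →
  (∀ i → Hyp.Connected (allFin m) E (block p i)) →
  (s : Fin m → ℚ) → Hyp.IsStrength (allFin m) E s →
  (∀ i e → E e ⊆ block p i → κ < s e) →
  (s' : Fin m → ℚ) → Hyp.IsStrength (contractEdges p E) (contractEdge p E) s' →
  ∀ e → (s e ≤ℚ κ) ⇔ ((¬ InBlock p E e) × (s' e ≤ℚ κ))
mainTheorem12 E _ κ p onto connected s strength strong s′ strength′ e = mk⇔ to from
  where
  open Contraction E p onto
  open Blocks strength strength′ (block-Φ> strength connected strong)
  to : s e ≤ℚ κ → ¬ InBlock p E e × s′ e ≤ℚ κ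
  to s≤κ = not-in-block , ℚ.≮⇒≥ (λ κ<s′ → <⇒≱ (Equivalence.from (<strength⇔<contracted not-in-block) κ<s′) s≤κ)
    where
    not-in-block : ¬ InBlock p E e
    not-in-block (i , e⊆block) = <⇒≱ (strong i e e⊆block) s≤κ
  from : ¬ InBlock p E e × s′ e ≤ℚ κ → s e ≤ℚ κ
  from (not-in-block , s′≤κ) = ℚ.≮⇒≥ (λ κ<s → <⇒≱ (Equivalence.to (<strength⇔<contracted not-in-block) κ<s) s′≤κ)
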